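{- Let $A=\{0=a_1<a_2<\dots<a_k\}$ be a $g_1$-Sidon set of integers and let $C\subseteq[1,q]$ be a set of integers that is a $g_2$-Sidon set modulo $q$. Then $B=\bigcup_{i=1}^k (C+qa_i)$ is a $g_1g_2$-Sidon set contained in $[1,q(a_k+1)]$ with $k|C|$ elements.
   Context: For a set $A$ in a commutative group (e.g. $\mathbb{Z}$ or $\mathbb{Z}_q$), the representation function is $r(x)=\#\{(a_1,a_2): a_1,a_2\in A,\ a_1+a_2=x\}$ (ordered pairs); $A$ is a $g$-Sidon set if $r(x)\le g$ for all $x$. A set of integers $C\subseteq[1,q]$ is a $g$-Sidon set modulo $q$ if the residue classes $\{c \bmod q: c\in C\}$ form a $g$-Sidon set in $\mathbb{Z}_q$. $C+qa_i=\{c+qa_i: c\in C\}$. -}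

module Defs where

open import Data.Nat using (ℕ; _+_; _*_; _≤_; _%_; NonZero)
open import Data.Nat.Properties using (_≟_)
open import Data.List using (List; length; filter; cartesianProduct; concatMap; map)
open import Data.Product using (_×_; _,_; proj₁; proj₂)

-- Finite sets of (nonnegative) integers are represented as lists of ℕ
-- (distinctness is imposed separately via Unique / Linked _<_).

rep : List ℕ → ℕ → ℕ
rep A x = length (filter (λ p → (proj₁ p + proj₂ p) ≟ x) (cartesianProduct A A))

-- A is a g-Sidon set (in ℤ; elements here are ≥ 0 so negative x have r = 0).
IsSidon : ℕ → List ℕ → Set
IsSidon g A = ∀ x → rep A x ≤ g

repMod : (q : ℕ) → .{{NonZero q}} → List ℕ → ℕ → ℕ
repMod q C x = length (filter (λ p → ((proj₁ p + proj₂ p) % q) ≟ (x % q)) (cartesianProduct C C))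

IsSidonMod : (q : ℕ) → .{{NonZero q}} → ℕ → List ℕ → Set
IsSidonMod q g C = ∀ x → repMod q C x ≤ g

blowUp : ℕ → List ℕ → List ℕ → List ℕ
blowUp q A C = concatMap (λ a → map (λ c → c + q * a) C) A

module Submission where

-- Every b ∈ B is c + q a with c ∈ C
-- and a ∈ A, so r_B(x) counts quadruples (a₁,c₁,a₂,c₂) with
-- (c₁ + c₂) + (a₁ + a₂) q = x.  Grouping by (c₁,c₂): such a quadruple
-- forces c₁ + c₂ ≡ x (mod q), and then a₁ + a₂ = (x − c₁ − c₂)/q is
-- determined, so at most g₁ pairs (a₁,a₂) contribute.  Summing over the
-- pairs (c₁,c₂) yields r_B(x) ≤ g₁ · r_C(x mod q) ≤ g₁ g₂.
-- Distinctness and the range [1, q(aₖ+1)] hold because the blocks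
-- C + q aᵢ ⊆ [q aᵢ + 1, q aᵢ + q] are disjoint and increasing in aᵢ.

open import Defs
open import Data.Bool using (true; false; if_then_else_)
open import Data.List using (List; []; _∷_; _++_; map; concatMap; cartesianProduct; filter; length; head; last)
open import Data.List.Properties using (length-++; length-map)
open import Data.List.Relation.Unary.All using (All; []; _∷_)
import Data.List.Relation.Unary.All as All
import Data.List.Relation.Unary.All.Properties as All
open import Data.List.Relation.Unary.AllPairs using (AllPairs; []; _∷_)
import Data.List.Relation.Unary.AllPairs as AllPairs
import Data.List.Relation.Unary.AllPairs.Properties as AllPairs
open import Data.List.Relation.Unary.Linked using (Linked; [-]; _∷_)
open import Data.List.Relation.Unary.Linked.Properties using (Linked⇒AllPairs)
open import Data.List.Relation.Unary.Unique.Propositional using (Unique)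
open import Data.Maybe using (just)
open import Data.Nat using (ℕ; _+_; _*_; _≤_; _<_; NonZero; suc; z≤n; _∸_; _%_; _/_)
open import Data.Nat.DivMod using (m*n/n≡m; [m+kn]%n≡m%n)
open import Data.Nat.Properties
open import Algebra.Properties.CommutativeSemigroup +-commutativeSemigroup using (interchange)
open import Data.Product using (_×_; _,_)
open import Relation.Nullary using (Dec; does; yes; no; ¬_)
open import Relation.Unary using (Pred; Decidable)
open import Relation.Binary.PropositionalEquality

∑ : {X : Set} → List X → (X → ℕ) → ℕ
∑ [] f = 0
∑ (x ∷ xs) f = f x + ∑ xs f

syntax ∑ xs (λ x → e) = ∑[ x ∈ xs ] e

𝟙 : {P : Set} → Dec P → ℕ
𝟙 d = if does d then 1 else 0

length-filter≡∑ : {X : Set} {P : Pred X _} (P? : Decidable P) (xs : List X) →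
  length (filter P? xs) ≡ ∑[ x ∈ xs ] 𝟙 (P? x)
length-filter≡∑ P? [] = refl
length-filter≡∑ P? (x ∷ xs) with does (P? x)
... | false = length-filter≡∑ P? xs
... | true = cong suc (length-filter≡∑ P? xs)

∑-++ : {X : Set} (xs ys : List X) (f : X → ℕ) → ∑ (xs ++ ys) f ≡ ∑ xs f + ∑ ys f
∑-++ [] ys f = refl
∑-++ (x ∷ xs) ys f = trans (cong (f x +_) (∑-++ xs ys f)) (sym (+-assoc (f x) _ _))

∑-map : {X Y : Set} (g : X → Y) (xs : List X) (f : Y → ℕ) →
  ∑ (map g xs) f ≡ ∑[ x ∈ xs ] f (g x)
∑-map g [] f = refl
∑-map g (x ∷ xs) f = cong (f (g x) +_) (∑-map g xs f)

∑-cong : {X : Set} (xs : List X) {f h : X → ℕ} → (∀ x → f x ≡ h x) → ∑ xs f ≡ ∑ xs h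
∑-cong [] e = refl
∑-cong (x ∷ xs) e = cong₂ _+_ (e x) (∑-cong xs e)

∑-mono : {X : Set} (xs : List X) {f h : X → ℕ} → (∀ x → f x ≤ h x) → ∑ xs f ≤ ∑ xs h
∑-mono [] e = z≤n
∑-mono (x ∷ xs) e = +-mono-≤ (e x) (∑-mono xs e)

∑-concatMap : {X Y : Set} (g : X → List Y) (xs : List X) (f : Y → ℕ) →
  ∑ (concatMap g xs) f ≡ ∑[ x ∈ xs ] ∑ (g x) f
∑-concatMap g [] f = refl
∑-concatMap g (x ∷ xs) f =
  trans (∑-++ (g x) (concatMap g xs) f) (cong (∑ (g x) f +_) (∑-concatMap g xs f))

∑-cartesianProduct : {X Y : Set} (xs : List X) (ys : List Y) (f : X × Y → ℕ) →
  ∑ (cartesianProduct xs ys) f ≡ ∑[ x ∈ xs ] ∑[ y ∈ ys ] f (x , y)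
∑-cartesianProduct [] ys f = refl
∑-cartesianProduct (x ∷ xs) ys f =
  trans (∑-++ (map (x ,_) ys) (cartesianProduct xs ys) f)
        (cong₂ _+_ (∑-map (x ,_) ys f) (∑-cartesianProduct xs ys f))

∑-zero : {X : Set} (xs : List X) → ∑[ _ ∈ xs ] 0 ≡ 0
∑-zero [] = refl
∑-zero (x ∷ xs) = ∑-zero xs

∑-+ : {X : Set} (xs : List X) (f h : X → ℕ) → ∑[ x ∈ xs ] (f x + h x) ≡ ∑ xs f + ∑ xs h
∑-+ [] f h = refl
∑-+ (x ∷ xs) f h =
  trans (cong (f x + h x +_) (∑-+ xs f h)) (interchange (f x) (h x) (∑ xs f) (∑ xs h))

∑-*ˡ : {X : Set} (xs : List X) (k : ℕ) (f : X → ℕ) → ∑[ x ∈ xs ] (k * f x) ≡ k * ∑ xs f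
∑-*ˡ [] k f = sym (*-zeroʳ k)
∑-*ˡ (x ∷ xs) k f = trans (cong (k * f x +_) (∑-*ˡ xs k f)) (sym (*-distribˡ-+ k (f x) _))

∑-swap : {X Y : Set} (xs : List X) (ys : List Y) (f : X → Y → ℕ) →
  ∑[ x ∈ xs ] ∑[ y ∈ ys ] f x y ≡ ∑[ y ∈ ys ] ∑[ x ∈ xs ] f x y
∑-swap [] ys f = sym (∑-zero ys)
∑-swap (x ∷ xs) ys f =
  trans (cong (∑ ys (f x) +_) (∑-swap xs ys f)) (sym (∑-+ ys (f x) (λ y → ∑[ x' ∈ xs ] f x' y)))

∑-regroup : {X Y : Set} (xs : List X) (ys : List Y) (f : X → Y → X → Y → ℕ) →
  ∑[ x₁ ∈ xs ] ∑[ y₁ ∈ ys ] ∑[ x₂ ∈ xs ] ∑[ y₂ ∈ ys ] f x₁ y₁ x₂ y₂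
    ≡ ∑[ y₁ ∈ ys ] ∑[ y₂ ∈ ys ] ∑[ x₁ ∈ xs ] ∑[ x₂ ∈ xs ] f x₁ y₁ x₂ y₂
∑-regroup xs ys f = begin
  ∑[ x₁ ∈ xs ] ∑[ y₁ ∈ ys ] ∑[ x₂ ∈ xs ] ∑[ y₂ ∈ ys ] f x₁ y₁ x₂ y₂
    ≡⟨ ∑-swap xs ys _ ⟩
  ∑[ y₁ ∈ ys ] ∑[ x₁ ∈ xs ] ∑[ x₂ ∈ xs ] ∑[ y₂ ∈ ys ] f x₁ y₁ x₂ y₂
    ≡⟨ ∑-cong ys (λ y₁ → ∑-cong xs (λ x₁ → ∑-swap xs ys _)) ⟩
  ∑[ y₁ ∈ ys ] ∑[ x₁ ∈ xs ] ∑[ y₂ ∈ ys ] ∑[ x₂ ∈ xs ] f x₁ y₁ x₂ y₂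
    ≡⟨ ∑-cong ys (λ y₁ → ∑-swap xs ys _) ⟩
  ∑[ y₁ ∈ ys ] ∑[ y₂ ∈ ys ] ∑[ x₁ ∈ xs ] ∑[ x₂ ∈ xs ] f x₁ y₁ x₂ y₂ ∎
  where open ≡-Reasoning

𝟙-mono : {P Q : Set} → (P → Q) → (p : Dec P) (q : Dec Q) → 𝟙 p ≤ 𝟙 q
𝟙-mono P⇒Q (yes p) (yes q) = ≤-refl
𝟙-mono P⇒Q (yes p) (no ¬q) with () ← ¬q (P⇒Q p)
𝟙-mono P⇒Q (no ¬p) q = z≤n

𝟙-no : {P : Set} → ¬ P → (p : Dec P) → 𝟙 p ≡ 0
𝟙-no ¬p (yes p) with () ← ¬p p
𝟙-no ¬p (no _) = refl

count-pairs : {X : Set} {P : Pred (X × X) _} (P? : Decidable P) (xs : List X) →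
  length (filter P? (cartesianProduct xs xs)) ≡ ∑[ x₁ ∈ xs ] ∑[ x₂ ∈ xs ] 𝟙 (P? (x₁ , x₂))
count-pairs P? xs = trans (length-filter≡∑ P? (cartesianProduct xs xs)) (∑-cartesianProduct xs xs _)

rep≡∑ : (A : List ℕ) (x : ℕ) → rep A x ≡ ∑[ a₁ ∈ A ] ∑[ a₂ ∈ A ] 𝟙 (a₁ + a₂ ≟ x)
rep≡∑ A x = count-pairs _ A

repMod≡∑ : (q : ℕ) .{{_ : NonZero q}} (C : List ℕ) (x : ℕ) →
  repMod q C x ≡ ∑[ c₁ ∈ C ] ∑[ c₂ ∈ C ] 𝟙 ((c₁ + c₂) % q ≟ x % q)
repMod≡∑ q C x = count-pairs _ C

∑-blowUp : (q : ℕ) (A C : List ℕ) (f : ℕ → ℕ) →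
  ∑ (blowUp q A C) f ≡ ∑[ a ∈ A ] ∑[ c ∈ C ] f (c + q * a)
∑-blowUp q A C f = trans (∑-concatMap (λ a → map (λ c → c + q * a) C) A f)
  (∑-cong A (λ a → ∑-map (λ c → c + q * a) C f))

blowUp-sum : ∀ q c₁ a₁ c₂ a₂ → (c₁ + q * a₁) + (c₂ + q * a₂) ≡ (c₁ + c₂) + (a₁ + a₂) * q
blowUp-sum q c₁ a₁ c₂ a₂ = begin
  (c₁ + q * a₁) + (c₂ + q * a₂) ≡⟨ interchange c₁ (q * a₁) c₂ (q * a₂) ⟩
  (c₁ + c₂) + (q * a₁ + q * a₂) ≡⟨ cong ((c₁ + c₂) +_) (sym (*-distribˡ-+ q a₁ a₂)) ⟩
  (c₁ + c₂) + q * (a₁ + a₂)     ≡⟨ cong ((c₁ + c₂) +_) (*-comm q (a₁ + a₂)) ⟩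
  (c₁ + c₂) + (a₁ + a₂) * q     ∎
  where open ≡-Reasoning

-- If s + (a₁ + a₂) q = x then x ≡ s (mod q)
-- and a₁ + a₂ = (x − s)/q is forced; so the pairs (a₁,a₂) ∈ A² with
-- s + (a₁ + a₂) q = x number at most g when s ≡ x (mod q), and none otherwise.
module _ (g q : ℕ) .{{_ : NonZero q}} (A : List ℕ) (sidonA : IsSidon g A) (s x : ℕ) where

  fibre : ℕ
  fibre = ∑[ a₁ ∈ A ] ∑[ a₂ ∈ A ] 𝟙 (s + (a₁ + a₂) * q ≟ x)

  fibre-congruent : fibre ≤ g
  fibre-congruent = begin
    fibre                                   ≤⟨ ∑-mono A (λ a₁ → ∑-mono A (λ a₂ →
                                                 𝟙-mono (quotient-forced a₁ a₂) (_ ≟ x) (_ ≟ y))) ⟩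
    ∑[ a₁ ∈ A ] ∑[ a₂ ∈ A ] 𝟙 (a₁ + a₂ ≟ y) ≡⟨ rep≡∑ A y ⟨
    rep A y                                 ≤⟨ sidonA y ⟩
    g                                       ∎
    where
    open ≤-Reasoning
    y : ℕ
    y = (x ∸ s) / q
    quotient-forced : ∀ a₁ a₂ → s + (a₁ + a₂) * q ≡ x → a₁ + a₂ ≡ y
    quotient-forced a₁ a₂ refl =
      sym (trans (cong (_/ q) (m+n∸m≡n s ((a₁ + a₂) * q))) (m*n/n≡m (a₁ + a₂) q))

  fibre-incongruent : s % q ≢ x % q → fibre ≡ 0
  fibre-incongruent s≢x = begin
    fibre                     ≡⟨ ∑-cong A (λ a₁ → ∑-cong A (λ a₂ →
                                   𝟙-no (residue-mismatch a₁ a₂) (_ ≟ x))) ⟩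
    ∑[ a₁ ∈ A ] ∑[ a₂ ∈ A ] 0 ≡⟨ ∑-cong A (λ _ → ∑-zero A) ⟩
    ∑[ a₁ ∈ A ] 0             ≡⟨ ∑-zero A ⟩
    0                         ∎
    where
    open ≡-Reasoning
    residue-mismatch : ∀ a₁ a₂ → ¬ (s + (a₁ + a₂) * q ≡ x)
    residue-mismatch a₁ a₂ refl = s≢x (sym ([m+kn]%n≡m%n s (a₁ + a₂) q))

  fibre-bound : fibre ≤ g * 𝟙 (s % q ≟ x % q)
  fibre-bound = by-residue (s % q ≟ x % q)
    where
    by-residue : (d : Dec (s % q ≡ x % q)) → fibre ≤ g * 𝟙 d
    by-residue (yes _) = ≤-trans fibre-congruent (≤-reflexive (sym (*-identityʳ g)))
    by-residue (no s≢x) = ≤-reflexive (trans (fibre-incongruent s≢x) (sym (*-zeroʳ g)))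

blowUp-sidon : (g₁ g₂ q : ℕ) .{{_ : NonZero q}} (A C : List ℕ) →
  IsSidon g₁ A → IsSidonMod q g₂ C → IsSidon (g₁ * g₂) (blowUp q A C)
blowUp-sidon g₁ g₂ q A C sidonA sidonC x = begin
  rep B x
    ≡⟨ rep≡∑ B x ⟩
  ∑[ b₁ ∈ B ] ∑[ b₂ ∈ B ] 𝟙 (b₁ + b₂ ≟ x)
    ≡⟨ trans (∑-blowUp q A C _) (∑-cong A (λ a₁ → ∑-cong C (λ c₁ → ∑-blowUp q A C _))) ⟩
  ∑[ a₁ ∈ A ] ∑[ c₁ ∈ C ] ∑[ a₂ ∈ A ] ∑[ c₂ ∈ C ] 𝟙 ((c₁ + q * a₁) + (c₂ + q * a₂) ≟ x)
    ≡⟨ ∑-regroup A C _ ⟩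
  ∑[ c₁ ∈ C ] ∑[ c₂ ∈ C ] ∑[ a₁ ∈ A ] ∑[ a₂ ∈ A ] 𝟙 ((c₁ + q * a₁) + (c₂ + q * a₂) ≟ x)
    ≡⟨ ∑-cong C (λ c₁ → ∑-cong C (λ c₂ → ∑-cong A (λ a₁ → ∑-cong A (λ a₂ →
         cong (λ n → 𝟙 (n ≟ x)) (blowUp-sum q c₁ a₁ c₂ a₂))))) ⟩
  ∑[ c₁ ∈ C ] ∑[ c₂ ∈ C ] ∑[ a₁ ∈ A ] ∑[ a₂ ∈ A ] 𝟙 ((c₁ + c₂) + (a₁ + a₂) * q ≟ x)
    ≤⟨ ∑-mono C (λ c₁ → ∑-mono C (λ c₂ → fibre-bound g₁ q A sidonA (c₁ + c₂) x)) ⟩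
  ∑[ c₁ ∈ C ] ∑[ c₂ ∈ C ] (g₁ * 𝟙 ((c₁ + c₂) % q ≟ x % q))
    ≡⟨ trans (∑-cong C (λ c₁ → ∑-*ˡ C g₁ _)) (∑-*ˡ C g₁ _) ⟩
  g₁ * ∑[ c₁ ∈ C ] ∑[ c₂ ∈ C ] 𝟙 ((c₁ + c₂) % q ≟ x % q)
    ≡⟨ cong (g₁ *_) (repMod≡∑ q C x) ⟨
  g₁ * repMod q C x
    ≤⟨ *-monoʳ-≤ g₁ (sidonC x) ⟩
  g₁ * g₂ ∎
  where
  open ≤-Reasoning
  B : List ℕ
  B = blowUp q A C

blowUp-all : {P Q R : ℕ → Set} (q : ℕ) (A C : List ℕ) → All P A → All Q C →
  (∀ {a c} → P a → Q c → R (c + q * a)) → All R (blowUp q A C)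
blowUp-all q [] C [] QC f = []
blowUp-all q (a ∷ A) C (Pa ∷ PA) QC f =
  All.++⁺ (All.map⁺ (All.map (f Pa) QC)) (blowUp-all q A C PA QC f)

InBlock : ℕ → ℕ → Set
InBlock q c = 1 ≤ c × c ≤ q

block-range : ∀ q k {a c} → a ≤ k → InBlock q c → 1 ≤ c + q * a × c + q * a ≤ q * (k + 1)
block-range q k {a} {c} a≤k (1≤c , c≤q) =
  ≤-trans 1≤c (m≤m+n c (q * a)) ,
  ≤-trans (+-mono-≤ c≤q (*-monoʳ-≤ q a≤k))
          (≤-reflexive (trans (sym (*-suc q k)) (cong (q *_) (+-comm 1 k))))

≤-last : (a : ℕ) (as : List ℕ) {k : ℕ} → Linked _<_ (a ∷ as) → last (a ∷ as) ≡ just k →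
  All (_≤ k) (a ∷ as)
≤-last a [] [-] refl = ≤-refl ∷ []
≤-last a (b ∷ bs) (a<b ∷ increasing) lastIsK with ≤-last b bs increasing lastIsK
... | b≤k ∷ rest = ≤-trans (<⇒≤ a<b) b≤k ∷ b≤k ∷ rest

blocks-ordered : ∀ q {a a' c c'} → a < a' → InBlock q c → InBlock q c' → c + q * a < c' + q * a'
blocks-ordered q {a} {a'} {c} {c'} a<a' (_ , c≤q) (1≤c' , _) = begin-strict
  c + q * a  ≤⟨ +-monoˡ-≤ (q * a) c≤q ⟩
  q + q * a  ≡⟨ *-suc q a ⟨
  q * suc a  ≤⟨ *-monoʳ-≤ q a<a' ⟩
  q * a'     <⟨ m<n+m (q * a') 1≤c' ⟩
  c' + q * a' ∎
  where open ≤-Reasoning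

-- Distinct elements: within a block by translation, across blocks by blocks-ordered.
blowUp-unique : (q : ℕ) (A C : List ℕ) → AllPairs _<_ A → Unique C → All (InBlock q) C →
  Unique (blowUp q A C)
blowUp-unique q [] C [] uniqueC inC = []
blowUp-unique q (a ∷ A) C (a<A ∷ increasing) uniqueC inC =
  AllPairs.++⁺ (AllPairs.map⁺ (AllPairs.map (λ c≢c' e → c≢c' (+-cancelʳ-≡ _ _ _ e)) uniqueC))
               (blowUp-unique q A C increasing uniqueC inC)
               (All.map⁺ (All.map (λ inc → blowUp-all q A C a<A inC
                 (λ a<a' inc' → <⇒≢ (blocks-ordered q a<a' inc inc'))) inC))

blowUp-length : (q : ℕ) (A C : List ℕ) → length (blowUp q A C) ≡ length A * length C
blowUp-length q [] C = refl
blowUp-length q (a ∷ A) C = trans (length-++ (map (λ c → c + q * a) C))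
  (cong₂ _+_ (length-map (λ c → c + q * a) C) (blowUp-length q A C))

lemma4 : (g₁ g₂ q aₖ : ℕ) → .{{_ : NonZero q}} → (A C : List ℕ) →
    Linked _<_ A → head A ≡ just 0 → last A ≡ just aₖ → IsSidon g₁ A →
    Unique C → All (λ c → 1 ≤ c × c ≤ q) C → IsSidonMod q g₂ C →
    IsSidon (g₁ * g₂) (blowUp q A C)
    × Unique (blowUp q A C)
    × All (λ b → 1 ≤ b × b ≤ q * (aₖ + 1)) (blowUp q A C)
    × length (blowUp q A C) ≡ length A * length C
lemma4 g₁ g₂ q aₖ (a ∷ A) C increasing _ lastIsAₖ sidonA uniqueC inC sidonC =
  blowUp-sidon g₁ g₂ q (a ∷ A) C sidonA sidonC ,
  blowUp-unique q (a ∷ A) C (Linked⇒AllPairs <-trans increasing) uniqueC inC ,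
  blowUp-all q (a ∷ A) C (≤-last a A increasing lastIsAₖ) inC (block-range q aₖ) ,
  blowUp-length q (a ∷ A) C
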